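{- The system $\mathsf{NL}+\{\mathrm{S}\}$, obtained by adding the axiom scheme (S) $(\varphi\otimes\psi)\Rightarrow\varphi$ to $\mathsf{NL}$, is inconsistent: every formula is a theorem of it.
   Context: Formulas: built from countably many variables with binary $\otimes,\circ$ and unary ${}^{*}$. Abbreviations: $\varphi\Rightarrow\psi:=(\varphi\circ\psi^{*})^{*}$; $\varphi\Leftrightarrow\psi:=(\varphi\Rightarrow\psi)\otimes(\psi\Rightarrow\varphi)$; $\varphi\not\Leftrightarrow\psi:=(\varphi\Leftrightarrow\psi)^{*}$; $\varphi\not\Leftrightarrow\psi\not\Leftrightarrow\chi:=((\varphi\not\Leftrightarrow\psi)\otimes(\varphi\not\Leftrightarrow\chi))\otimes(\psi\not\Leftrightarrow\chi)$. The theorems of $\mathsf{NL}$ are generated from all instances of the axiom schemes (A1) $\varphi\Rightarrow\varphi$; (A2) $(\varphi\circ\psi)\Rightarrow(\psi\circ\varphi)$; (A3) $\varphi\Rightarrow\varphi^{**}$; (A4) $(\varphi\Rightarrow\psi)\Rightarrow(\varphi\circ\psi)$; (A5) $(\varphi\otimes\psi)\Leftrightarrow(\psi\otimes\varphi)$; (A6) $((\varphi\otimes\psi)\Rightarrow\chi)\Rightarrow((\varphi\otimes\chi^{*})\Rightarrow\psi^{*})$; (A7) $(\varphi\not\Leftrightarrow\psi\not\Leftrightarrow\chi)\Rightarrow((\varphi\Rightarrow\psi)\Rightarrow((\psi\Rightarrow\chi)\Rightarrow(\varphi\Rightarrow\chi)))$ by the rules, applied to theorems only: from $\vdash\varphi\Rightarrow\psi$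 and $\vdash\varphi$ infer $\vdash\psi$; from $\vdash\varphi$ and $\vdash\psi$ infer $\vdash\varphi\otimes\psi$; from $\vdash\varphi\Leftrightarrow\psi$ and $\vdash\chi$ infer $\vdash\chi'$ ($\chi'$ obtained from $\chi$ by replacing one or more occurrences of $\varphi$ by $\psi$); from $\vdash\varphi\otimes\psi$ infer $\vdash\varphi$. -}

module Defs where

open import Data.Nat using (ℕ)

data Fm : Set where
  var : ℕ → Fm
  _⊗_ : Fm → Fm → Fm
  _∘_ : Fm → Fm → Fm
  _* : Fm → Fm

infixl 30 _*
infixr 20 _⊗_ _∘_
infixr 10 _⇒_ _⇔_ _⇎_

_⇒_ : Fm → Fm → Fm
φ ⇒ ψ = (φ ∘ (ψ *)) *

_⇔_ : Fm → Fm → Fm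
φ ⇔ ψ = (φ ⇒ ψ) ⊗ (ψ ⇒ φ)

_⇎_ : Fm → Fm → Fm
φ ⇎ ψ = (φ ⇔ ψ) *

-- φ ⇎ ψ ⇎ χ  :=  ((φ⇎ψ) ⊗ (φ⇎χ)) ⊗ (ψ⇎χ)
⇎3 : Fm → Fm → Fm → Fm
⇎3 φ ψ χ = ((φ ⇎ ψ) ⊗ (φ ⇎ χ)) ⊗ (ψ ⇎ χ)

data ReplAny (φ ψ : Fm) : Fm → Fm → Set where
  here  : ReplAny φ ψ φ ψ
  rvar  : ∀ n → ReplAny φ ψ (var n) (var n)
  r⊗    : ∀ {a a' b b'} → ReplAny φ ψ a a' → ReplAny φ ψ b b' → ReplAny φ ψ (a ⊗ b) (a' ⊗ b')
  r∘    : ∀ {a a' b b'} → ReplAny φ ψ a a' → ReplAny φ ψ b b' → ReplAny φ ψ (a ∘ b) (a' ∘ b')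
  r*    : ∀ {a a'} → ReplAny φ ψ a a' → ReplAny φ ψ (a *) (a' *)

data Repl (φ ψ : Fm) : Fm → Fm → Set where
  here  : Repl φ ψ φ ψ
  r⊗ˡ   : ∀ {a a' b b'} → Repl φ ψ a a' → ReplAny φ ψ b b' → Repl φ ψ (a ⊗ b) (a' ⊗ b')
  r⊗ʳ   : ∀ {a a' b b'} → ReplAny φ ψ a a' → Repl φ ψ b b' → Repl φ ψ (a ⊗ b) (a' ⊗ b')
  r∘ˡ   : ∀ {a a' b b'} → Repl φ ψ a a' → ReplAny φ ψ b b' → Repl φ ψ (a ∘ b) (a' ∘ b')
  r∘ʳ   : ∀ {a a' b b'} → ReplAny φ ψ a a' → Repl φ ψ b b' → Repl φ ψ (a ∘ b) (a' ∘ b')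
  r*    : ∀ {a a'} → Repl φ ψ a a' → Repl φ ψ (a *) (a' *)

data ⊢S : Fm → Set where
  A1 : ∀ φ → ⊢S (φ ⇒ φ)
  A2 : ∀ φ ψ → ⊢S ((φ ∘ ψ) ⇒ (ψ ∘ φ))
  A3 : ∀ φ → ⊢S (φ ⇒ φ * *)
  A4 : ∀ φ ψ → ⊢S ((φ ⇒ ψ) ⇒ (φ ∘ ψ))
  A5 : ∀ φ ψ → ⊢S ((φ ⊗ ψ) ⇔ (ψ ⊗ φ))
  A6 : ∀ φ ψ χ → ⊢S (((φ ⊗ ψ) ⇒ χ) ⇒ ((φ ⊗ (χ *)) ⇒ (ψ *)))
  A7 : ∀ φ ψ χ → ⊢S (⇎3 φ ψ χ ⇒ ((φ ⇒ ψ) ⇒ ((ψ ⇒ χ) ⇒ (φ ⇒ χ))))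
  AS : ∀ φ ψ → ⊢S ((φ ⊗ ψ) ⇒ φ)
  MP : ∀ {φ ψ} → ⊢S (φ ⇒ ψ) → ⊢S φ → ⊢S ψ
  ADJ : ∀ {φ ψ} → ⊢S φ → ⊢S ψ → ⊢S (φ ⊗ ψ)
  SUB : ∀ {φ ψ χ χ'} → ⊢S (φ ⇔ ψ) → ⊢S χ → Repl φ ψ χ χ' → ⊢S χ'
  SIMP : ∀ {φ ψ} → ⊢S (φ ⊗ ψ) → ⊢S φ

{-# OPTIONS --safe #-}
module Submission where

open import Defs

-- Under S, φ ⊗ φ * implies φ and, after commuting by A5, also φ *; A4 and A3
-- turn the latter into the negation of χ := (φ ⊗ φ *) ⇒ φ, so χ ⊗ χ * is a
-- theorem. From any such theorem A6, applied to the S-instance (χ ⊗ ψ) ⇒ χ,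
-- yields ψ * for every ψ; for ψ = χ ∘ φ * this is χ ⇒ φ, whence φ.

ReplAny-refl : ∀ {φ ψ} χ → ReplAny φ ψ χ χ
ReplAny-refl (var n) = rvar n
ReplAny-refl (a ⊗ b) = r⊗ (ReplAny-refl a) (ReplAny-refl b)
ReplAny-refl (a ∘ b) = r∘ (ReplAny-refl a) (ReplAny-refl b)
ReplAny-refl (a *)   = r* (ReplAny-refl a)

⊗-projʳ : ∀ φ ψ → ⊢S ((φ ⊗ ψ) ⇒ ψ)
⊗-projʳ φ ψ = SUB (A5 ψ φ) (AS ψ φ) (r* (r∘ˡ here (ReplAny-refl (ψ *))))

⇒*-refutes-⇒ : ∀ {φ ψ} → ⊢S (φ ⇒ ψ *) → ⊢S ((φ ⇒ ψ) *)
⇒*-refutes-⇒ {φ} {ψ} φ⇒ψ* = MP (A3 (φ ∘ ψ *)) (MP (A4 φ (ψ *)) φ⇒ψ*)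

⊗*-theorem : ∀ φ → ⊢S (((φ ⊗ φ *) ⇒ φ) ⊗ ((φ ⊗ φ *) ⇒ φ) *)
⊗*-theorem φ = ADJ (AS φ (φ *)) (⇒*-refutes-⇒ (⊗-projʳ φ (φ *)))

⊗*-refutes-all : ∀ {χ} → ⊢S (χ ⊗ χ *) → ∀ ψ → ⊢S (ψ *)
⊗*-refutes-all {χ} χ⊗χ* ψ = MP (MP (A6 χ ψ χ) (AS χ ψ)) χ⊗χ*

⊗*-proves-all : ∀ {χ} → ⊢S (χ ⊗ χ *) → ∀ φ → ⊢S φ
⊗*-proves-all {χ} χ⊗χ* φ = MP (⊗*-refutes-all χ⊗χ* (χ ∘ φ *)) (SIMP χ⊗χ*)

proposition3p2 : ∀ (φ : Fm) → ⊢S φ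
proposition3p2 φ = ⊗*-proves-all (⊗*-theorem φ) φ
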